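{- Let $k\ge 2$ and let $a,b$ be indeterminates over $\mathbb{Q}$. Write $1-ax-bx^k=\prod_{i=1}^k(1-\gamma_ix)$ with $\gamma_i$ in an algebraic closure of $\mathbb{Q}(a,b)$. Then $\gamma_1,\ldots,\gamma_k$ are nonzero and pairwise distinct. Moreover, if $\gamma_i\gamma_j=\gamma_s\gamma_t$ for some $1\le i,j,s,t\le k$, then $(i,j)=(s,t)$ or $(i,j)=(t,s)$. -}

module Defs where

open import Level using (_⊔_)
open import Algebra.Bundles using (CommutativeRing)
open import Data.Nat using (ℕ; zero; suc)
open import Data.Integer using (ℤ; +_; -[1+_])
open import Data.List using (List; []; _∷_; _++_; replicate; map)
open import Data.List.Relation.Unary.All using (All)
open import Data.List.Relation.Unary.Any using (Any)
open import Data.Fin as F using (Fin)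
open import Data.Product using (_×_; ∃)
open import Relation.Nullary using (¬_)
open import Relation.Binary.PropositionalEquality using (_≡_)

module _ {c ℓ} (K : CommutativeRing c ℓ) where
  open CommutativeRing K hiding (zero)

  -- Univariate polynomials over K as coefficient lists, constant term first.
  Poly : Set c
  Poly = List Carrier

  _⊕_ : Poly → Poly → Poly
  [] ⊕ q = q
  (x ∷ p) ⊕ [] = x ∷ p
  (x ∷ p) ⊕ (y ∷ q) = (x + y) ∷ (p ⊕ q)

  scale : Carrier → Poly → Poly
  scale x = map (x *_)

  _⊛_ : Poly → Poly → Poly
  [] ⊛ q = []
  (x ∷ p) ⊛ q = scale x q ⊕ (0# ∷ (p ⊛ q))

  monomial : ℕ → Carrier → Poly
  monomial n x = replicate n 0# ++ (x ∷ [])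

  _≈P_ : Poly → Poly → Set (c ⊔ ℓ)
  [] ≈P q = All (_≈ 0#) q
  (x ∷ p) ≈P [] = All (_≈ 0#) (x ∷ p)
  (x ∷ p) ≈P (y ∷ q) = (x ≈ y) × (p ≈P q)

  evalP : Poly → Carrier → Carrier
  evalP [] r = 0#
  evalP (x ∷ p) r = x + r * evalP p r

  prodLin : (k : ℕ) → (Fin k → Carrier) → Poly
  prodLin zero γ = 1# ∷ []
  prodLin (suc k) γ = (1# ∷ (- γ F.zero) ∷ []) ⊛ prodLin k (λ i → γ (F.suc i))

  trinomial : ℕ → Carrier → Carrier → Poly
  trinomial k a b = (1# ∷ (- a) ∷ []) ⊕ monomial k (- b)

  natK : ℕ → Carrier
  natK zero = 0#
  natK (suc n) = 1# + natK n

  intK : ℤ → Carrier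
  intK (+ n) = natK n
  intK -[1+ n ] = - natK (suc n)

  -- Integer polynomials in two variables: p = Σ_i Σ_j p_ij X^i Y^j,
  -- row i lists the coefficients p_ij (j = 0,1,..).
  eval2 : List (List ℤ) → Carrier → Carrier → Carrier
  eval2 p x y = evalP (map (λ row → evalP (map intK row) y) p) x

  NonZeroPoly2 : List (List ℤ) → Set
  NonZeroPoly2 p = Any (Any (λ z → ¬ (z ≡ + 0))) p

  -- x, y algebraically independent over ℤ (equivalently over ℚ; this also
  -- forces characteristic 0): no nonzero integer polynomial vanishes at (x,y).
  AlgIndep : Carrier → Carrier → Set ℓ
  AlgIndep x y = ∀ p → NonZeroPoly2 p → ¬ (eval2 p x y ≈ 0#)

  IsField : Set (c ⊔ ℓ)
  IsField = (¬ (1# ≈ 0#)) × (∀ x → ¬ (x ≈ 0#) → ∃ λ y → x * y ≈ 1#)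

  -- Every monic polynomial of degree ≥ 1 has a root.
  AlgClosed : Set (c ⊔ ℓ)
  AlgClosed = ∀ (x : Carrier) (cs : List Carrier) →
              ∃ λ r → evalP (x ∷ cs ++ (1# ∷ [])) r ≈ 0#

{-# OPTIONS --safe #-}
module Submission where

-- If some γᵢ were 0, the product would have degree < k, forcing b = 0.  So every γᵢ is
-- invertible and 1/γᵢ is a root of 1 - a x - b x^k, i.e. γᵢ^k = a γᵢ^(k-1) + b.  If γᵢ = γⱼ
-- with i ≠ j, then 1/γᵢ is a double root, hence a root of the derivative: a γᵢ^(k-1) = - k b.
-- Eliminating γᵢ gives k^k b + (k-1)^(k-1) a^k = 0, contradicting algebraic independence.
-- If γᵢ γⱼ = γₛ γₜ, multiplying the relations γ^(k-1) (γ - a) = b for γᵢ, γⱼ and for γₛ, γₜ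
-- gives (γᵢ - a)(γⱼ - a) = (γₛ - a)(γₜ - a), so γᵢ + γⱼ = γₛ + γₜ as a ≠ 0; and a pair is
-- determined up to order by its sum and product.

open import Defs
open import Algebra.Bundles using (CommutativeRing)
open import Data.Nat as ℕ using (ℕ; zero; suc; _<_; _≤_; s≤s)
import Data.Nat.Properties as ℕ
open import Data.Integer using (ℤ; +_)
import Data.Integer.Properties as ℤ
open import Data.Fin as Fin using (Fin)
open import Data.Product using (_×_; _,_; proj₁; proj₂)
open import Data.Sum using (_⊎_; inj₁; inj₂)
open import Data.List using (List; []; _∷_; _++_; replicate; map)
open import Data.List.Properties using (map-++; map-replicate)
open import Data.List.Relation.Unary.All using (All; []; _∷_)
open import Data.List.Relation.Unary.Any using (here; there)
open import Function using (_∘_)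
open import Relation.Nullary using (¬_; yes; no; contradiction)
open import Relation.Binary.PropositionalEquality as ≡ using (_≡_; _≢_)

module Polynomial {c ℓ} (K : CommutativeRing c ℓ) where
  open CommutativeRing K hiding (zero)
  open import Algebra.Properties.Ring ring using (-‿distribʳ-*; -0#≈0#)
  open import Algebra.Properties.CommutativeSemigroup +-commutativeSemigroup using (interchange)
  open import Algebra.Properties.CommutativeSemigroup *-commutativeSemigroup using (x∙yz≈y∙xz)
  open import Algebra.Properties.CommutativeSemiring.Exp commutativeSemiring
    using (_^_; ^-congˡ; ^-distrib-*)
  open import Algebra.Solver.Ring.NaturalCoefficients.Default commutativeSemiring
    using (solve; _:=_; _:+_; _:*_; con)
  open import Relation.Binary.Reasoning.Setoid setoid

  x≈0⇒x*y≈0 : ∀ {x y} → x ≈ 0# → x * y ≈ 0#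
  x≈0⇒x*y≈0 {y = y} x≈0 = trans (*-congʳ x≈0) (zeroˡ y)

  y≈0⇒x*y≈0 : ∀ {x y} → y ≈ 0# → x * y ≈ 0#
  y≈0⇒x*y≈0 {x} y≈0 = trans (*-congˡ y≈0) (zeroʳ x)

  x≈0⇒y≈0⇒x+y≈0 : ∀ {x y} → x ≈ 0# → y ≈ 0# → x + y ≈ 0#
  x≈0⇒y≈0⇒x+y≈0 x≈0 y≈0 = trans (+-cong x≈0 y≈0) (+-identityʳ 0#)

  eval-zeros : ∀ {p} r → All (_≈ 0#) p → evalP K p r ≈ 0#
  eval-zeros r []          = refl
  eval-zeros r (x≈0 ∷ p≈0) = x≈0⇒y≈0⇒x+y≈0 x≈0 (y≈0⇒x*y≈0 (eval-zeros r p≈0))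

  eval-cong : ∀ p q r → _≈P_ K p q → evalP K p r ≈ evalP K q r
  eval-cong []      q       r q≈0         = sym (eval-zeros r q≈0)
  eval-cong (x ∷ p) []      r p≈0         = eval-zeros r p≈0
  eval-cong (x ∷ p) (y ∷ q) r (x≈y , p≈q) = +-cong x≈y (*-congˡ (eval-cong p q r p≈q))

  eval-⊕ : ∀ p q r → evalP K (_⊕_ K p q) r ≈ evalP K p r + evalP K q r
  eval-⊕ []      q       r = sym (+-identityˡ _)
  eval-⊕ (x ∷ p) []      r = sym (+-identityʳ _)
  eval-⊕ (x ∷ p) (y ∷ q) r = begin
    (x + y) + r * evalP K (_⊕_ K p q) r
      ≈⟨ +-congˡ (trans (*-congˡ (eval-⊕ p q r)) (distribˡ r _ _)) ⟩
    (x + y) + (r * evalP K p r + r * evalP K q r)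
      ≈⟨ interchange x y _ _ ⟩
    (x + r * evalP K p r) + (y + r * evalP K q r) ∎

  eval-scale : ∀ x q r → evalP K (scale K x q) r ≈ x * evalP K q r
  eval-scale x []      r = sym (zeroʳ x)
  eval-scale x (y ∷ q) r = begin
    x * y + r * evalP K (scale K x q) r
      ≈⟨ +-congˡ (trans (*-congˡ (eval-scale x q r)) (x∙yz≈y∙xz r x _)) ⟩
    x * y + x * (r * evalP K q r)
      ≈⟨ distribˡ x y _ ⟨
    x * (y + r * evalP K q r) ∎

  eval-⊛ : ∀ p q r → evalP K (_⊛_ K p q) r ≈ evalP K p r * evalP K q r
  eval-⊛ []      q r = sym (zeroˡ _)
  eval-⊛ (x ∷ p) q r = begin
    evalP K (_⊕_ K (scale K x q) (0# ∷ _⊛_ K p q)) r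
      ≈⟨ eval-⊕ (scale K x q) _ r ⟩
    evalP K (scale K x q) r + (0# + r * evalP K (_⊛_ K p q) r)
      ≈⟨ +-cong (eval-scale x q r) (+-congˡ (*-congˡ (eval-⊛ p q r))) ⟩
    x * Q + (0# + r * (P * Q))
      ≈⟨ solve 4 (λ x r P Q → x :* Q :+ (con 0 :+ r :* (P :* Q)) := (x :+ r :* P) :* Q) refl x r P Q ⟩
    (x + r * P) * Q ∎
    where
    P = evalP K p r
    Q = evalP K q r

  eval-monomial : ∀ n x r → evalP K (monomial K n x) r ≈ x * r ^ n
  eval-monomial zero    x r = solve 2 (λ x r → x :+ r :* con 0 := x :* con 1) refl x r
  eval-monomial (suc n) x r = begin
    0# + r * evalP K (monomial K n x) r ≈⟨ +-identityˡ _ ⟩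
    r * evalP K (monomial K n x) r      ≈⟨ *-congˡ (eval-monomial n x r) ⟩
    r * (x * r ^ n)                     ≈⟨ x∙yz≈y∙xz r x _ ⟩
    x * (r * r ^ n)                     ∎

  eval-linear-root : ∀ {g r} → g * r ≈ 1# → evalP K (1# ∷ - g ∷ []) r ≈ 0#
  eval-linear-root {g} {r} g*r≈1 = begin
    1# + r * (- g + r * 0#) ≈⟨ +-congˡ (*-congˡ (trans (+-congˡ (zeroʳ r)) (+-identityʳ (- g)))) ⟩
    1# + r * - g            ≈⟨ +-congˡ (-‿distribʳ-* r g) ⟨
    1# - r * g              ≈⟨ +-congˡ (-‿cong (trans (*-comm r g) g*r≈1)) ⟩
    1# - 1#                 ≈⟨ -‿inverseʳ 1# ⟩
    0#                      ∎

  eval-prodLin-root : ∀ k γ (i : Fin k) {r} → γ i * r ≈ 1# → evalP K (prodLin K k γ) r ≈ 0#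
  eval-prodLin-root (suc k) γ i {r} γi*r≈1 =
    trans (eval-⊛ (1# ∷ - γ Fin.zero ∷ []) (prodLin K k (γ ∘ Fin.suc)) r) (factor-vanishes i γi*r≈1)
    where
    factor-vanishes : ∀ i → γ i * r ≈ 1# →
      evalP K (1# ∷ - γ Fin.zero ∷ []) r * evalP K (prodLin K k (γ ∘ Fin.suc)) r ≈ 0#
    factor-vanishes Fin.zero    = x≈0⇒x*y≈0 ∘ eval-linear-root
    factor-vanishes (Fin.suc i) = y≈0⇒x*y≈0 ∘ eval-prodLin-root k (γ ∘ Fin.suc) i

  -- eval′ p r is the value at r of the formal derivative of p.
  eval′ : Poly K → Carrier → Carrier
  eval′ []      r = 0#
  eval′ (x ∷ p) r = evalP K p r + r * eval′ p r

  eval′-zeros : ∀ {p} r → All (_≈ 0#) p → eval′ p r ≈ 0#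
  eval′-zeros r []        = refl
  eval′-zeros r (_ ∷ p≈0) = x≈0⇒y≈0⇒x+y≈0 (eval-zeros r p≈0) (y≈0⇒x*y≈0 (eval′-zeros r p≈0))

  eval′-cong : ∀ p q r → _≈P_ K p q → eval′ p r ≈ eval′ q r
  eval′-cong []      q       r q≈0       = sym (eval′-zeros r q≈0)
  eval′-cong (x ∷ p) []      r p≈0       = eval′-zeros r p≈0
  eval′-cong (x ∷ p) (y ∷ q) r (_ , p≈q) = +-cong (eval-cong p q r p≈q) (*-congˡ (eval′-cong p q r p≈q))

  eval′-⊕ : ∀ p q r → eval′ (_⊕_ K p q) r ≈ eval′ p r + eval′ q r
  eval′-⊕ []      q       r = sym (+-identityˡ _)
  eval′-⊕ (x ∷ p) []      r = sym (+-identityʳ _)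
  eval′-⊕ (x ∷ p) (y ∷ q) r = begin
    evalP K (_⊕_ K p q) r + r * eval′ (_⊕_ K p q) r
      ≈⟨ +-cong (eval-⊕ p q r) (trans (*-congˡ (eval′-⊕ p q r)) (distribˡ r _ _)) ⟩
    (evalP K p r + evalP K q r) + (r * eval′ p r + r * eval′ q r)
      ≈⟨ interchange _ _ _ _ ⟩
    (evalP K p r + r * eval′ p r) + (evalP K q r + r * eval′ q r) ∎

  eval′-scale : ∀ x q r → eval′ (scale K x q) r ≈ x * eval′ q r
  eval′-scale x []      r = sym (zeroʳ x)
  eval′-scale x (y ∷ q) r = begin
    evalP K (scale K x q) r + r * eval′ (scale K x q) r
      ≈⟨ +-cong (eval-scale x q r) (trans (*-congˡ (eval′-scale x q r)) (x∙yz≈y∙xz r x _)) ⟩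
    x * evalP K q r + x * (r * eval′ q r)
      ≈⟨ distribˡ x _ _ ⟨
    x * (evalP K q r + r * eval′ q r) ∎

  eval′-⊛ : ∀ p q r → eval′ (_⊛_ K p q) r ≈ eval′ p r * evalP K q r + evalP K p r * eval′ q r
  eval′-⊛ []      q r = sym (x≈0⇒y≈0⇒x+y≈0 (zeroˡ _) (zeroˡ _))
  eval′-⊛ (x ∷ p) q r = begin
    eval′ (_⊕_ K (scale K x q) (0# ∷ _⊛_ K p q)) r
      ≈⟨ eval′-⊕ (scale K x q) _ r ⟩
    eval′ (scale K x q) r + (evalP K (_⊛_ K p q) r + r * eval′ (_⊛_ K p q) r)
      ≈⟨ +-cong (eval′-scale x q r) (+-cong (eval-⊛ p q r) (*-congˡ (eval′-⊛ p q r))) ⟩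
    x * Q′ + (P * Q + r * (P′ * Q + P * Q′))
      ≈⟨ solve 6 (λ x r P P′ Q Q′ → x :* Q′ :+ (P :* Q :+ r :* (P′ :* Q :+ P :* Q′))
                                    := (P :+ r :* P′) :* Q :+ (x :+ r :* P) :* Q′) refl x r P P′ Q Q′ ⟩
    (P + r * P′) * Q + (x + r * P) * Q′ ∎
    where
    P  = evalP K p r
    P′ = eval′ p r
    Q  = evalP K q r
    Q′ = eval′ q r

  eval′-monomial : ∀ n x r → eval′ (monomial K (suc n) x) r ≈ x * natK K (suc n) * r ^ n
  eval′-monomial zero    x r =
    solve 2 (λ x r → (x :+ r :* con 0) :+ r :* (con 0 :+ r :* con 0) := x :* (con 1 :+ con 0) :* con 1) refl x r
  eval′-monomial (suc n) x r = begin
    evalP K (monomial K (suc n) x) r + r * eval′ (monomial K (suc n) x) r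
      ≈⟨ +-cong (eval-monomial (suc n) x r) (*-congˡ (eval′-monomial n x r)) ⟩
    x * (r * r ^ n) + r * (x * natK K (suc n) * r ^ n)
      ≈⟨ solve 4 (λ x r R N → x :* (r :* R) :+ r :* (x :* N :* R) := x :* (con 1 :+ N) :* (r :* R))
               refl x r (r ^ n) (natK K (suc n)) ⟩
    x * (1# + natK K (suc n)) * (r * r ^ n) ∎

  eval′-prodLin-double-root : ∀ k γ {i j : Fin k} {r} → i ≢ j → γ i * r ≈ 1# → γ j * r ≈ 1# →
                              eval′ (prodLin K k γ) r ≈ 0#
  eval′-prodLin-double-root (suc k) γ {i} {j} {r} i≢j γi*r≈1 γj*r≈1 =
    trans (eval′-⊛ L P r) (terms-vanish i j i≢j γi*r≈1 γj*r≈1)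
    where
    L = 1# ∷ - γ Fin.zero ∷ []
    P = prodLin K k (γ ∘ Fin.suc)
    terms-vanish : ∀ i j → i ≢ j → γ i * r ≈ 1# → γ j * r ≈ 1# →
                   eval′ L r * evalP K P r + evalP K L r * eval′ P r ≈ 0#
    terms-vanish Fin.zero    Fin.zero    i≢j _ _ = contradiction ≡.refl i≢j
    terms-vanish Fin.zero    (Fin.suc j) _ hi hj = x≈0⇒y≈0⇒x+y≈0
      (y≈0⇒x*y≈0 (eval-prodLin-root k (γ ∘ Fin.suc) j hj)) (x≈0⇒x*y≈0 (eval-linear-root hi))
    terms-vanish (Fin.suc i) Fin.zero    _ hi hj = x≈0⇒y≈0⇒x+y≈0
      (y≈0⇒x*y≈0 (eval-prodLin-root k (γ ∘ Fin.suc) i hi)) (x≈0⇒x*y≈0 (eval-linear-root hj))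
    terms-vanish (Fin.suc i) (Fin.suc j) i≢j hi hj = x≈0⇒y≈0⇒x+y≈0
      (y≈0⇒x*y≈0 (eval-prodLin-root k (γ ∘ Fin.suc) i hi))
      (y≈0⇒x*y≈0 (eval′-prodLin-double-root k (γ ∘ Fin.suc) (i≢j ∘ ≡.cong Fin.suc) hi hj))

  coeff : Poly K → ℕ → Carrier
  coeff []      n       = 0#
  coeff (x ∷ p) zero    = x
  coeff (x ∷ p) (suc n) = coeff p n

  coeff-zeros : ∀ {p} n → All (_≈ 0#) p → coeff p n ≈ 0#
  coeff-zeros n       []        = refl
  coeff-zeros zero    (x≈0 ∷ _) = x≈0
  coeff-zeros (suc n) (_ ∷ p≈0) = coeff-zeros n p≈0

  coeff-cong : ∀ p q n → _≈P_ K p q → coeff p n ≈ coeff q n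
  coeff-cong []      q       n       q≈0       = sym (coeff-zeros n q≈0)
  coeff-cong (x ∷ p) []      n       p≈0       = coeff-zeros n p≈0
  coeff-cong (x ∷ p) (y ∷ q) zero    (x≈y , _) = x≈y
  coeff-cong (x ∷ p) (y ∷ q) (suc n) (_ , p≈q) = coeff-cong p q n p≈q

  coeff-⊕ : ∀ p q n → coeff (_⊕_ K p q) n ≈ coeff p n + coeff q n
  coeff-⊕ []      q       n       = sym (+-identityˡ _)
  coeff-⊕ (x ∷ p) []      n       = sym (+-identityʳ _)
  coeff-⊕ (x ∷ p) (y ∷ q) zero    = refl
  coeff-⊕ (x ∷ p) (y ∷ q) (suc n) = coeff-⊕ p q n

  coeff-scale : ∀ x q n → coeff (scale K x q) n ≈ x * coeff q n
  coeff-scale x []      n       = sym (zeroʳ x)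
  coeff-scale x (y ∷ q) zero    = refl
  coeff-scale x (y ∷ q) (suc n) = coeff-scale x q n

  coeff-monomial : ∀ n x → coeff (monomial K n x) n ≈ x
  coeff-monomial zero    x = refl
  coeff-monomial (suc n) x = coeff-monomial n x

  coeff-linear-⊛ : ∀ x y q n → coeff (_⊛_ K (x ∷ y ∷ []) q) (suc n) ≈ x * coeff q (suc n) + y * coeff q n
  coeff-linear-⊛ x y q n = begin
    coeff (_⊕_ K (scale K x q) (0# ∷ _⊕_ K (scale K y q) (0# ∷ []))) (suc n)
      ≈⟨ coeff-⊕ (scale K x q) _ (suc n) ⟩
    coeff (scale K x q) (suc n) + coeff (_⊕_ K (scale K y q) (0# ∷ [])) n
      ≈⟨ +-cong (coeff-scale x q (suc n)) (coeff-⊕ (scale K y q) _ n) ⟩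
    x * coeff q (suc n) + (coeff (scale K y q) n + coeff (0# ∷ []) n)
      ≈⟨ +-congˡ (+-cong (coeff-scale y q n) (coeff-zeros n (refl ∷ []))) ⟩
    x * coeff q (suc n) + (y * coeff q n + 0#)
      ≈⟨ +-congˡ (+-identityʳ _) ⟩
    x * coeff q (suc n) + y * coeff q n ∎

  coeff-prodLin-above : ∀ k γ {n} → k < n → coeff (prodLin K k γ) n ≈ 0#
  coeff-prodLin-above zero    γ {suc n} _         = refl
  coeff-prodLin-above (suc k) γ {suc n} (s≤s k<n) =
    trans (coeff-linear-⊛ 1# (- γ Fin.zero) (prodLin K k (γ ∘ Fin.suc)) n)
          (x≈0⇒y≈0⇒x+y≈0 (y≈0⇒x*y≈0 (coeff-prodLin-above k (γ ∘ Fin.suc) (ℕ.m<n⇒m<1+n k<n)))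
                          (y≈0⇒x*y≈0 (coeff-prodLin-above k (γ ∘ Fin.suc) k<n)))

  coeff-prodLin-degree : ∀ k γ (i : Fin k) → γ i ≈ 0# → coeff (prodLin K k γ) k ≈ 0#
  coeff-prodLin-degree (suc k) γ i γi≈0 =
    trans (coeff-linear-⊛ 1# (- γ Fin.zero) (prodLin K k (γ ∘ Fin.suc)) k)
          (x≈0⇒y≈0⇒x+y≈0 (y≈0⇒x*y≈0 (coeff-prodLin-above k (γ ∘ Fin.suc) (ℕ.n<1+n k)))
                          (last-term i γi≈0))
    where
    last-term : ∀ i → γ i ≈ 0# → - γ Fin.zero * coeff (prodLin K k (γ ∘ Fin.suc)) k ≈ 0#
    last-term Fin.zero    γ0≈0 = x≈0⇒x*y≈0 (trans (-‿cong γ0≈0) -0#≈0#)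
    last-term (Fin.suc i) γi≈0 = y≈0⇒x*y≈0 (coeff-prodLin-degree k (γ ∘ Fin.suc) i γi≈0)

  coeff-trinomial-degree : ∀ n a b → coeff (trinomial K (suc (suc n)) a b) (suc (suc n)) ≈ - b
  coeff-trinomial-degree n a b = coeff-monomial n (- b)

  eval-trinomial : ∀ m a b r → evalP K (trinomial K (suc m) a b) r + (a * r + b * r ^ suc m) ≈ 1#
  eval-trinomial m a b r = begin
    evalP K (trinomial K (suc m) a b) r + (a * r + b * r ^ suc m)
      ≈⟨ +-congʳ (trans (eval-⊕ (1# ∷ - a ∷ []) (monomial K (suc m) (- b)) r)
                        (+-congˡ (eval-monomial (suc m) (- b) r))) ⟩
    ((1# + r * (- a + r * 0#)) + - b * r ^ suc m) + (a * r + b * r ^ suc m)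
      ≈⟨ solve 6 (λ r R a -a b -b → ((con 1 :+ r :* (-a :+ r :* con 0)) :+ -b :* R) :+ (a :* r :+ b :* R)
                                     := con 1 :+ ((-a :+ a) :* r :+ (-b :+ b) :* R))
               refl r (r ^ suc m) a (- a) b (- b) ⟩
    1# + ((- a + a) * r + (- b + b) * r ^ suc m)
      ≈⟨ +-congˡ (x≈0⇒y≈0⇒x+y≈0 (x≈0⇒x*y≈0 (-‿inverseˡ a)) (x≈0⇒x*y≈0 (-‿inverseˡ b))) ⟩
    1# + 0#
      ≈⟨ +-identityʳ 1# ⟩
    1# ∎

  eval′-trinomial : ∀ m a b r → eval′ (trinomial K (suc m) a b) r + (a + b * natK K (suc m) * r ^ m) ≈ 0#
  eval′-trinomial m a b r = begin
    eval′ (trinomial K (suc m) a b) r + (a + b * N * r ^ m)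
      ≈⟨ +-congʳ (trans (eval′-⊕ (1# ∷ - a ∷ []) (monomial K (suc m) (- b)) r)
                        (+-congˡ (eval′-monomial m (- b) r))) ⟩
    (((- a + r * 0#) + r * (0# + r * 0#)) + - b * N * r ^ m) + (a + b * N * r ^ m)
      ≈⟨ solve 7 (λ r R N a -a b -b → (((-a :+ r :* con 0) :+ r :* (con 0 :+ r :* con 0)) :+ -b :* N :* R)
                                         :+ (a :+ b :* N :* R)
                                       := (-a :+ a) :+ (-b :+ b) :* N :* R)
               refl r (r ^ m) N a (- a) b (- b) ⟩
    (- a + a) + (- b + b) * N * r ^ m
      ≈⟨ x≈0⇒y≈0⇒x+y≈0 (-‿inverseˡ a) (x≈0⇒x*y≈0 (x≈0⇒x*y≈0 (-‿inverseˡ b))) ⟩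
    0# ∎
    where N = natK K (suc m)

  1#^n≈1# : ∀ n → 1# ^ n ≈ 1#
  1#^n≈1# zero    = refl
  1#^n≈1# (suc n) = trans (*-identityˡ _) (1#^n≈1# n)

  ^-inverse : ∀ {x y} n → x * y ≈ 1# → x ^ n * y ^ n ≈ 1#
  ^-inverse {x} {y} n x*y≈1 = trans (sym (^-distrib-* x y n)) (trans (^-congˡ n x*y≈1) (1#^n≈1# n))

  reciprocal-root : ∀ m {a b γ r} → γ * r ≈ 1# → a * r + b * r ^ suc m ≈ 1# → γ ^ suc m ≈ a * γ ^ m + b
  reciprocal-root m {a} {b} {γ} {r} γ*r≈1 root = begin
    γ ^ suc m
      ≈⟨ trans (*-congˡ root) (*-identityʳ _) ⟨
    γ ^ suc m * (a * r + b * r ^ suc m)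
      ≈⟨ solve 6 (λ γ Γ r R a b → (γ :* Γ) :* (a :* r :+ b :* (r :* R))
                                  := a :* (Γ :* (γ :* r)) :+ b :* ((γ :* Γ) :* (r :* R)))
               refl γ (γ ^ m) r (r ^ m) a b ⟩
    a * (γ ^ m * (γ * r)) + b * (γ ^ suc m * r ^ suc m)
      ≈⟨ +-cong (*-congˡ (*-congˡ γ*r≈1)) (*-congˡ (^-inverse (suc m) γ*r≈1)) ⟩
    a * (γ ^ m * 1#) + b * 1#
      ≈⟨ +-cong (*-congˡ (*-identityʳ _)) (*-identityʳ b) ⟩
    a * γ ^ m + b ∎

  reciprocal-critical : ∀ m {a c γ r} → γ * r ≈ 1# → a + c * r ^ m ≈ 0# → a * γ ^ m + c ≈ 0#
  reciprocal-critical m {a} {c} {γ} {r} γ*r≈1 critical = begin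
    a * γ ^ m + c                   ≈⟨ +-congˡ (trans (*-congˡ (^-inverse m γ*r≈1)) (*-identityʳ c)) ⟨
    a * γ ^ m + c * (γ ^ m * r ^ m) ≈⟨ solve 4 (λ a c Γ R → a :* Γ :+ c :* (Γ :* R) := Γ :* (a :+ c :* R))
                                              refl a c (γ ^ m) (r ^ m) ⟩
    γ ^ m * (a + c * r ^ m)         ≈⟨ y≈0⇒x*y≈0 critical ⟩
    0#                              ∎

  -- Substituting α^(m+1) and β^(m+1), both sides become 2a²(αβ)^m + ab(α^m + β^m) + b².
  root-pair-identity : ∀ m {a b α β} → α ^ suc m ≈ a * α ^ m + b → β ^ suc m ≈ a * β ^ m + b →
                       (α * β) ^ m * (α * β + a * a) ≈ b * b + a * (α * β) ^ m * (α + β)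
  root-pair-identity m {a} {b} {α} {β} rootα rootβ = begin
    (α * β) ^ m * (α * β + a * a)
      ≈⟨ *-congʳ (^-distrib-* α β m) ⟩
    A * B * (α * β + a * a)
      ≈⟨ solve 5 (λ α β A B a → A :* B :* (α :* β :+ a :* a) := (α :* A) :* (β :* B) :+ a :* a :* (A :* B))
               refl α β A B a ⟩
    α ^ suc m * β ^ suc m + a * a * (A * B)
      ≈⟨ +-congʳ (*-cong rootα rootβ) ⟩
    (a * A + b) * (a * B + b) + a * a * (A * B)
      ≈⟨ solve 4 (λ A B a b → (a :* A :+ b) :* (a :* B :+ b) :+ a :* a :* (A :* B)
                              := b :* b :+ a :* (B :* (a :* A :+ b) :+ A :* (a :* B :+ b)))
               refl A B a b ⟩
    b * b + a * (B * (a * A + b) + A * (a * B + b))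
      ≈⟨ +-congˡ (*-congˡ (+-cong (*-congˡ rootα) (*-congˡ rootβ))) ⟨
    b * b + a * (B * α ^ suc m + A * β ^ suc m)
      ≈⟨ +-congˡ (solve 5 (λ α β A B a → a :* (B :* (α :* A) :+ A :* (β :* B)) := a :* (A :* B) :* (α :+ β))
                          refl α β A B a) ⟩
    b * b + a * (A * B) * (α + β)
      ≈⟨ +-congˡ (*-congʳ (*-congˡ (^-distrib-* α β m))) ⟨
    b * b + a * (α * β) ^ m * (α + β) ∎
    where
    A = α ^ m
    B = β ^ m

module FieldProperties {c ℓ} (K : CommutativeRing c ℓ) (isField : IsField K) where
  open CommutativeRing K hiding (zero)
  open Polynomial K using (root-pair-identity)
  open import Algebra.Properties.Ring ring using (-0#≈0#; -‿distribʳ-*; [y-z]x≈yx-zx)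
  open import Algebra.Properties.Group +-group
    using (∙-cancelˡ; x∙y⁻¹≈ε⇒x≈y; ⁻¹-involutive; inverseˡ-unique)
  open import Algebra.Properties.AbelianGroup +-abelianGroup using (⁻¹-∙-comm)
  open import Algebra.Properties.CommutativeSemigroup +-commutativeSemigroup using (interchange)
  open import Algebra.Properties.CommutativeSemiring.Exp commutativeSemiring
    using (_^_; ^-congˡ; ^-congʳ; ^-distrib-*; ^-assocʳ)
  open import Algebra.Solver.Ring.NaturalCoefficients.Default commutativeSemiring
    using (solve; _:=_; _:*_)
  open import Relation.Binary.Reasoning.Setoid setoid

  *-cancelˡ : ∀ {x y z} → x ≉ 0# → x * y ≈ x * z → y ≈ z
  *-cancelˡ {x} {y} {z} x≉0 x*y≈x*z = begin
    y             ≈⟨ *-identityˡ y ⟨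
    1# * y        ≈⟨ *-congʳ x⁻¹*x≈1 ⟨
    x⁻¹ * x * y   ≈⟨ *-assoc x⁻¹ x y ⟩
    x⁻¹ * (x * y) ≈⟨ *-congˡ x*y≈x*z ⟩
    x⁻¹ * (x * z) ≈⟨ *-assoc x⁻¹ x z ⟨
    x⁻¹ * x * z   ≈⟨ *-congʳ x⁻¹*x≈1 ⟩
    1# * z        ≈⟨ *-identityˡ z ⟩
    z             ∎
    where
    x⁻¹ = proj₁ (proj₂ isField x x≉0)
    x⁻¹*x≈1 = trans (*-comm x⁻¹ x) (proj₂ (proj₂ isField x x≉0))

  *-≉0 : ∀ {x y} → x ≉ 0# → y ≉ 0# → x * y ≉ 0#
  *-≉0 {x} x≉0 y≉0 x*y≈0 = y≉0 (*-cancelˡ x≉0 (trans x*y≈0 (sym (zeroʳ x))))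

  ^-≉0 : ∀ {x} n → x ≉ 0# → x ^ n ≉ 0#
  ^-≉0 zero    x≉0 = proj₁ isField
  ^-≉0 (suc n) x≉0 = *-≉0 x≉0 (^-≉0 n x≉0)

  -‿≉0 : ∀ {x} → x ≉ 0# → - x ≉ 0#
  -‿≉0 {x} x≉0 -x≈0 = x≉0 (trans (sym (⁻¹-involutive x)) (trans (-‿cong -x≈0) -0#≈0#))

  ^-swap : ∀ x m n → (x ^ m) ^ n ≈ (x ^ n) ^ m
  ^-swap x m n = trans (^-assocʳ x m n) (trans (^-congʳ x (ℕ.*-comm m n)) (sym (^-assocʳ x n m)))

  -- Raise the second equation to the power m+1 and use the first to remove γ.
  eliminate : ∀ m {a c u v γ} → c ≉ 0# → γ ^ suc m ≈ u * c → a * γ ^ m ≈ v * c →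
              c * v ^ suc m ≈ a ^ suc m * u ^ m
  eliminate m {a} {c} {u} {v} {γ} c≉0 γ^[m+1]≈uc aγ^m≈vc = *-cancelˡ (^-≉0 m c≉0) (begin
    c ^ m * (c * v ^ suc m)     ≈⟨ solve 3 (λ c C V → C :* (c :* V) := V :* (c :* C)) refl c (c ^ m) (v ^ suc m) ⟩
    v ^ suc m * c ^ suc m       ≈⟨ ^-distrib-* v c (suc m) ⟨
    (v * c) ^ suc m             ≈⟨ ^-congˡ (suc m) aγ^m≈vc ⟨
    (a * γ ^ m) ^ suc m         ≈⟨ ^-distrib-* a (γ ^ m) (suc m) ⟩
    a ^ suc m * (γ ^ m) ^ suc m ≈⟨ *-congˡ (^-swap γ m (suc m)) ⟩
    a ^ suc m * (γ ^ suc m) ^ m ≈⟨ *-congˡ (trans (^-congˡ m γ^[m+1]≈uc) (^-distrib-* u c m)) ⟩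
    a ^ suc m * (u ^ m * c ^ m) ≈⟨ solve 3 (λ A U C → A :* (U :* C) := C :* (A :* U)) refl (a ^ suc m) (u ^ m) (c ^ m) ⟩
    c ^ m * (a ^ suc m * u ^ m) ∎)

  -- The hypotheses say that 1/γ is a root of 1 - a x - b x^(m+1) and of its derivative.
  double-root⇒discriminant≈0 : ∀ m {a b γ} → b ≉ 0# →
    γ ^ suc m ≈ a * γ ^ m + b → a * γ ^ m + b * natK K (suc m) ≈ 0# →
    b * natK K (suc m) ^ suc m + a ^ suc m * natK K m ^ m ≈ 0#
  double-root⇒discriminant≈0 m {a} {b} {γ} b≉0 root critical = begin
    b * N ^ suc m + a ^ suc m * M ^ m ≈⟨ +-congˡ (eliminate m (-‿≉0 b≉0) γ^[m+1]≈M[-b] aγ^m≈N[-b]) ⟨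
    b * N ^ suc m + - b * N ^ suc m   ≈⟨ distribʳ (N ^ suc m) b (- b) ⟨
    (b - b) * N ^ suc m               ≈⟨ trans (*-congʳ (-‿inverseʳ b)) (zeroˡ _) ⟩
    0#                                ∎
    where
    N = natK K (suc m)
    M = natK K m
    aγ^m≈N[-b] : a * γ ^ m ≈ N * - b
    aγ^m≈N[-b] = trans (inverseˡ-unique _ _ critical) (trans (-‿cong (*-comm b N)) (-‿distribʳ-* N b))
    γ^[m+1]≈M[-b] : γ ^ suc m ≈ M * - b
    γ^[m+1]≈M[-b] = begin
      γ ^ suc m                ≈⟨ root ⟩
      a * γ ^ m + b            ≈⟨ +-congʳ aγ^m≈N[-b] ⟩
      (1# + M) * - b + b       ≈⟨ +-congʳ (distribʳ (- b) 1# M) ⟩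
      (1# * - b + M * - b) + b ≈⟨ +-congʳ (trans (+-congʳ (*-identityˡ (- b))) (+-comm (- b) _)) ⟩
      (M * - b + - b) + b      ≈⟨ +-assoc _ (- b) b ⟩
      M * - b + (- b + b)      ≈⟨ trans (+-congˡ (-‿inverseˡ b)) (+-identityʳ _) ⟩
      M * - b                  ∎

  root-pairs-same-sum : ∀ m {a b α β δ ε} → a ≉ 0# → α ≉ 0# → β ≉ 0# →
    α ^ suc m ≈ a * α ^ m + b → β ^ suc m ≈ a * β ^ m + b →
    δ ^ suc m ≈ a * δ ^ m + b → ε ^ suc m ≈ a * ε ^ m + b →
    α * β ≈ δ * ε → α + β ≈ δ + ε
  root-pairs-same-sum m {a} {b} {α} {β} {δ} {ε} a≉0 α≉0 β≉0 rootα rootβ rootδ rootε αβ≈δε =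
    *-cancelˡ (*-≉0 a≉0 (^-≉0 m (*-≉0 α≉0 β≉0))) (∙-cancelˡ (b * b) _ _ (begin
      b * b + a * (α * β) ^ m * (α + β) ≈⟨ root-pair-identity m rootα rootβ ⟨
      (α * β) ^ m * (α * β + a * a)     ≈⟨ *-cong [αβ]^m≈[δε]^m (+-congʳ αβ≈δε) ⟩
      (δ * ε) ^ m * (δ * ε + a * a)     ≈⟨ root-pair-identity m rootδ rootε ⟩
      b * b + a * (δ * ε) ^ m * (δ + ε) ≈⟨ +-congˡ (*-congʳ (*-congˡ [αβ]^m≈[δε]^m)) ⟨
      b * b + a * (α * β) ^ m * (δ + ε) ∎))
    where [αβ]^m≈[δε]^m = ^-congˡ m αβ≈δε

  [x+z]-[y+z]≈x-y : ∀ x y z → (x + z) - (y + z) ≈ x - y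
  [x+z]-[y+z]≈x-y x y z = begin
    (x + z) - (y + z)     ≈⟨ +-congˡ (⁻¹-∙-comm y z) ⟨
    (x + z) + (- y + - z) ≈⟨ interchange x z (- y) (- z) ⟩
    (x - y) + (z - z)     ≈⟨ +-congˡ (-‿inverseʳ z) ⟩
    (x - y) + 0#          ≈⟨ +-identityʳ _ ⟩
    x - y                 ∎

  x+w≈y+z⇒x-y≈z-w : ∀ {x y z w} → x + w ≈ y + z → x - y ≈ z - w
  x+w≈y+z⇒x-y≈z-w {x} {y} {z} {w} x+w≈y+z = begin
    x - y             ≈⟨ [x+z]-[y+z]≈x-y x y w ⟨
    (x + w) - (y + w) ≈⟨ +-cong (trans x+w≈y+z (+-comm y z)) (-‿cong (+-comm y w)) ⟩
    (z + y) - (w + y) ≈⟨ [x+z]-[y+z]≈x-y z w y ⟩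
    z - w             ∎

  same-sum-and-product : ∀ {α β δ ε} → α + β ≈ δ + ε → α * β ≈ δ * ε → α ≉ δ → α ≈ ε × β ≈ δ
  same-sum-and-product {α} {β} {δ} {ε} sum product α≉δ = α≈ε , β≈δ
    where
    αα+δε≈δα+αε : α * α + δ * ε ≈ δ * α + α * ε
    αα+δε≈δα+αε = begin
      α * α + δ * ε ≈⟨ +-congˡ product ⟨
      α * α + α * β ≈⟨ distribˡ α α β ⟨
      α * (α + β)   ≈⟨ *-congˡ sum ⟩
      α * (δ + ε)   ≈⟨ distribˡ α δ ε ⟩
      α * δ + α * ε ≈⟨ +-congʳ (*-comm α δ) ⟩
      δ * α + α * ε ∎
    α≈ε : α ≈ ε
    α≈ε = *-cancelˡ (α≉δ ∘ x∙y⁻¹≈ε⇒x≈y α δ) (begin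
      (α - δ) * α   ≈⟨ [y-z]x≈yx-zx α α δ ⟩
      α * α - δ * α ≈⟨ x+w≈y+z⇒x-y≈z-w αα+δε≈δα+αε ⟩
      α * ε - δ * ε ≈⟨ [y-z]x≈yx-zx ε α δ ⟨
      (α - δ) * ε   ∎)
    β≈δ : β ≈ δ
    β≈δ = ∙-cancelˡ α β δ (begin
      α + β ≈⟨ sum ⟩
      δ + ε ≈⟨ +-comm δ ε ⟩
      ε + δ ≈⟨ +-congʳ α≈ε ⟨
      α + δ ∎)

module Independence {c ℓ} (K : CommutativeRing c ℓ) where
  open CommutativeRing K hiding (zero)
  open Polynomial K using (eval-monomial)
  open import Algebra.Properties.CommutativeSemiring.Exp commutativeSemiring using (_^_)
  open import Algebra.Properties.Semiring.Mult semiring using (×1-homo-*) renaming (_×_ to _×ᵣ_)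
  open import Algebra.Solver.Ring.NaturalCoefficients.Default commutativeSemiring
    using (solve; _:=_; _:+_; _:*_; con)
  open import Relation.Binary.Reasoning.Setoid setoid

  natK≡×1# : ∀ n → natK K n ≡ n ×ᵣ 1#
  natK≡×1# zero    = ≡.refl
  natK≡×1# (suc n) = ≡.cong (_+_ 1#) (natK≡×1# n)

  natK-^ : ∀ m n → natK K (m ℕ.^ n) ≈ natK K m ^ n
  natK-^ m zero    = +-identityʳ 1#
  natK-^ m (suc n) = begin
    natK K (m ℕ.* m ℕ.^ n)         ≡⟨ natK≡×1# (m ℕ.* m ℕ.^ n) ⟩
    (m ℕ.* m ℕ.^ n) ×ᵣ 1#          ≈⟨ ×1-homo-* m (m ℕ.^ n) ⟩
    (m ×ᵣ 1#) * ((m ℕ.^ n) ×ᵣ 1#)  ≡⟨ ≡.cong₂ _*_ (natK≡×1# m) (natK≡×1# (m ℕ.^ n)) ⟨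
    natK K m * natK K (m ℕ.^ n)    ≈⟨ *-congˡ (natK-^ m n) ⟩
    natK K m * natK K m ^ n        ∎

  X Y : List (List ℤ)
  X = [] ∷ (+ 1 ∷ []) ∷ []
  Y = (+ 0 ∷ + 1 ∷ []) ∷ []

  discriminant : ℕ → List (List ℤ)
  discriminant m = (+ 0 ∷ + (suc m ℕ.^ suc m) ∷ []) ∷ replicate m [] ++ (+ (m ℕ.^ m) ∷ []) ∷ []

  eval2-X : ∀ x y → eval2 K X x y ≈ x
  eval2-X = solve 2 (λ x y → con 0 :+ x :* (((con 1 :+ con 0) :+ y :* con 0) :+ x :* con 0) := x) refl

  eval2-Y : ∀ x y → eval2 K Y x y ≈ y
  eval2-Y = solve 2 (λ x y → (con 0 :+ y :* ((con 1 :+ con 0) :+ y :* con 0)) :+ x :* con 0 := y) refl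

  eval2-discriminant : ∀ m x y →
    eval2 K (discriminant m) x y ≈ y * natK K (suc m) ^ suc m + x ^ suc m * natK K m ^ m
  eval2-discriminant m x y = begin
    row₀ + x * evalP K (map evalRow (replicate m [] ++ (+ M ∷ []) ∷ [])) x
      ≡⟨ ≡.cong (λ p → row₀ + x * evalP K p x) higher-rows ⟩
    row₀ + x * evalP K (monomial K m (natK K M + y * 0#)) x
      ≈⟨ +-congˡ (*-congˡ (eval-monomial m _ x)) ⟩
    (0# + y * (natK K N + y * 0#)) + x * ((natK K M + y * 0#) * x ^ m)
      ≈⟨ solve 5 (λ x y X n m → (con 0 :+ y :* (n :+ y :* con 0)) :+ x :* ((m :+ y :* con 0) :* X)
                                := y :* n :+ x :* X :* m)
               refl x y (x ^ m) (natK K N) (natK K M) ⟩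
    y * natK K N + x ^ suc m * natK K M
      ≈⟨ +-cong (*-congˡ (natK-^ (suc m) (suc m))) (*-congˡ (natK-^ m m)) ⟩
    y * natK K (suc m) ^ suc m + x ^ suc m * natK K m ^ m ∎
    where
    N = suc m ℕ.^ suc m
    M = m ℕ.^ m
    evalRow : List ℤ → Carrier
    evalRow row = evalP K (map (intK K) row) y
    row₀ = evalRow (+ 0 ∷ + N ∷ [])
    higher-rows : map evalRow (replicate m [] ++ (+ M ∷ []) ∷ []) ≡ monomial K m (evalRow (+ M ∷ []))
    higher-rows = ≡.trans (map-++ evalRow (replicate m []) _)
                          (≡.cong (_++ (evalRow (+ M ∷ []) ∷ [])) (map-replicate evalRow m []))

  module _ {a b} (indep : AlgIndep K a b) where
    algIndep⇒x≉0 : a ≉ 0#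
    algIndep⇒x≉0 a≈0 = indep X (there (here (here λ ()))) (trans (eval2-X a b) a≈0)

    algIndep⇒y≉0 : b ≉ 0#
    algIndep⇒y≉0 b≈0 = indep Y (here (there (here λ ()))) (trans (eval2-Y a b) b≈0)

    algIndep⇒discriminant≉0 : ∀ m → b * natK K (suc m) ^ suc m + a ^ suc m * natK K m ^ m ≉ 0#
    algIndep⇒discriminant≉0 m disc≈0 =
      indep (discriminant m) (here (there (here N≢0))) (trans (eval2-discriminant m a b) disc≈0)
      where
      N≢0 : + (suc m ℕ.^ suc m) ≢ + 0
      N≢0 = ℕ.1+n≢0 ∘ ℕ.m^n≡0⇒m≡0 (suc m) (suc m) ∘ ℤ.+-injective

module Factorisation {c ℓ} (K : CommutativeRing c ℓ) (isField : IsField K) (n : ℕ)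
  {a b : CommutativeRing.Carrier K} (indep : AlgIndep K a b)
  (γ : Fin (suc (suc n)) → CommutativeRing.Carrier K)
  (factorisation : _≈P_ K (trinomial K (suc (suc n)) a b) (prodLin K (suc (suc n)) γ)) where
  open CommutativeRing K hiding (zero)
  open Polynomial K
  open FieldProperties K isField
  open Independence K
  open import Algebra.Properties.Ring ring using (-0#≈0#)
  open import Algebra.Properties.Group +-group using (⁻¹-involutive)
  open import Algebra.Properties.CommutativeSemiring.Exp commutativeSemiring using (_^_)
  open import Relation.Binary.Reasoning.Setoid setoid

  m k : ℕ
  m = suc n
  k = suc m

  γ≉0 : ∀ i → γ i ≉ 0#
  γ≉0 i γi≈0 = algIndep⇒y≉0 indep (begin
    b                             ≈⟨ ⁻¹-involutive b ⟨
    - - b                         ≈⟨ -‿cong (coeff-trinomial-degree n a b) ⟨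
    - coeff (trinomial K k a b) k ≈⟨ -‿cong (coeff-cong _ _ k factorisation) ⟩
    - coeff (prodLin K k γ) k     ≈⟨ -‿cong (coeff-prodLin-degree k γ i γi≈0) ⟩
    - 0#                          ≈⟨ -0#≈0# ⟩
    0#                            ∎)

  γ⁻¹ : Fin k → Carrier
  γ⁻¹ i = proj₁ (proj₂ isField (γ i) (γ≉0 i))

  γ*γ⁻¹≈1 : ∀ i → γ i * γ⁻¹ i ≈ 1#
  γ*γ⁻¹≈1 i = proj₂ (proj₂ isField (γ i) (γ≉0 i))

  root : ∀ i → γ i ^ k ≈ a * γ i ^ m + b
  root i = reciprocal-root m (γ*γ⁻¹≈1 i) (begin
    a * r + b * r ^ k                                   ≈⟨ +-identityˡ _ ⟨
    0# + (a * r + b * r ^ k)                            ≈⟨ +-congʳ trinomial-vanishes ⟨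
    evalP K (trinomial K k a b) r + (a * r + b * r ^ k) ≈⟨ eval-trinomial m a b r ⟩
    1#                                                  ∎)
    where
    r = γ⁻¹ i
    trinomial-vanishes : evalP K (trinomial K k a b) r ≈ 0#
    trinomial-vanishes = trans (eval-cong _ _ r factorisation) (eval-prodLin-root k γ i (γ*γ⁻¹≈1 i))

  γ-distinct : ∀ i j → i ≢ j → γ i ≉ γ j
  γ-distinct i j i≢j γi≈γj =
    algIndep⇒discriminant≉0 indep m (double-root⇒discriminant≈0 m (algIndep⇒y≉0 indep) (root i) critical)
    where
    r = γ⁻¹ i
    derivative-vanishes : eval′ (trinomial K k a b) r ≈ 0#
    derivative-vanishes = trans (eval′-cong _ _ r factorisation)
      (eval′-prodLin-double-root k γ i≢j (γ*γ⁻¹≈1 i) (trans (*-congʳ (sym γi≈γj)) (γ*γ⁻¹≈1 i)))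
    critical : a * γ i ^ m + b * natK K k ≈ 0#
    critical = reciprocal-critical m (γ*γ⁻¹≈1 i) (begin
      a + b * natK K k * r ^ m                                 ≈⟨ +-identityˡ _ ⟨
      0# + (a + b * natK K k * r ^ m)                          ≈⟨ +-congʳ derivative-vanishes ⟨
      eval′ (trinomial K k a b) r + (a + b * natK K k * r ^ m) ≈⟨ eval′-trinomial m a b r ⟩
      0#                                                       ∎)

  γ-injective : ∀ {i j} → γ i ≈ γ j → i ≡ j
  γ-injective {i} {j} γi≈γj with i Fin.≟ j
  ... | yes i≡j = i≡j
  ... | no  i≢j = contradiction γi≈γj (γ-distinct i j i≢j)

  γ-products-distinct : ∀ i j s t → γ i * γ j ≈ γ s * γ t → (i ≡ s × j ≡ t) ⊎ (i ≡ t × j ≡ s)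
  γ-products-distinct i j s t γiγj≈γsγt with i Fin.≟ s
  ... | yes ≡.refl = inj₁ (≡.refl , γ-injective (*-cancelˡ (γ≉0 i) γiγj≈γsγt))
  ... | no  i≢s    = inj₂ (γ-injective (proj₁ pairs-swap) , γ-injective (proj₂ pairs-swap))
    where
    same-sum = root-pairs-same-sum m (algIndep⇒x≉0 indep) (γ≉0 i) (γ≉0 j)
                 (root i) (root j) (root s) (root t) γiγj≈γsγt
    pairs-swap = same-sum-and-product same-sum γiγj≈γsγt (γ-distinct i s i≢s)

-- Algebraic closure only guarantees that the γᵢ exist; here they are given.
lemma4p1 : ∀ {c ℓ} (K : CommutativeRing c ℓ) → IsField K → AlgClosed K →
           (k : ℕ) → 2 ≤ k →
           (a b : CommutativeRing.Carrier K) → AlgIndep K a b →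
           (γ : Fin k → CommutativeRing.Carrier K) →
           _≈P_ K (trinomial K k a b) (prodLin K k γ) →
           let open CommutativeRing K in
           (∀ i → ¬ (γ i ≈ 0#))
           × (∀ i j → ¬ (i ≡ j) → ¬ (γ i ≈ γ j))
           × (∀ i j s t → (γ i * γ j) ≈ (γ s * γ t) →
                ((i ≡ s) × (j ≡ t)) ⊎ ((i ≡ t) × (j ≡ s)))
lemma4p1 K isField _ (suc (suc n)) (s≤s (s≤s _)) a b indep γ factorisation =
  γ≉0 , γ-distinct , γ-products-distinct
  where open Factorisation K isField n indep γ factorisation
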